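{- For every $n\in\omega$, the van der Waerden ideal $\mathcal{W}$ does not belong to $\mathcal{SP}_n$; that is, $\mathcal{W}$ is not contained in any countable union of $n$-porous subsets of $2^\omega$.
   Context: $\omega=\{0,1,2,\dots\}$; subsets of $\omega$ are identified with elements of $2^\omega$. $2^{<\omega}$ is the set of finite binary sequences; for $s\in 2^{<\omega}$, $[s]=\{x\in 2^\omega: s\subseteq x\}$, and $s^\frown t$ denotes concatenation. For $m\ge1$, $E_m$ is the family of subsets of $\omega$ containing no arithmetic progression $\{a,a+r,\dots,a+(m-1)r\}$ with $r>0$; $\mathcal{W}=\bigcup_m E_m$. A set $A\subseteq 2^\omega$ is $n$-porous if for every $s\in 2^{<\omega}$ there is $t\in 2^{<\omega}$ with $|t|=n$ and $[s^\frown t]\cap A=\emptyset$. $\mathcal{SP}_n$ is the $\sigma$-ideal of subsets of $2^\omega$ generated by the $n$-porous sets. -}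

module Defs where

open import Data.Nat using (ℕ; zero; suc; _+_; _*_; _<_; _≥_)
open import Data.Bool using (Bool; true)
open import Data.List using (List; []; _∷_; _++_; length)
open import Data.Product using (Σ; _×_)
open import Data.Unit using (⊤)
open import Relation.Nullary using (¬_)
open import Relation.Binary.PropositionalEquality using (_≡_)

-- 2^ω : subsets of ω identified with characteristic functions
Cantor : Set
Cantor = ℕ → Bool

SubsetOfCantor : Set₁
SubsetOfCantor = Cantor → Set

ContainsAP : ℕ → Cantor → Set
ContainsAP m x = Σ ℕ λ a → Σ ℕ λ r → (0 < r) × (∀ j → j < m → x (a + j * r) ≡ true)

E : ℕ → SubsetOfCantor
E m x = ¬ ContainsAP m x

W : SubsetOfCantor
W x = Σ ℕ λ m → (m ≥ 1) × E m x

Extends : List Bool → Cantor → Set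
Extends [] x = ⊤
Extends (b ∷ s) x = (x 0 ≡ b) × Extends s (λ i → x (suc i))

NPorous : ℕ → SubsetOfCantor → Set
NPorous n A = ∀ (s : List Bool) → Σ (List Bool) λ t →
  (length t ≡ n) × (∀ x → Extends (s ++ t) x → ¬ A x)

InSP : ℕ → SubsetOfCantor → Set₁
InSP n B = Σ (ℕ → SubsetOfCantor) λ A →
  (∀ k → NPorous n (A k)) × (∀ x → B x → Σ ℕ λ k → A k x)

{-# OPTIONS --safe #-}
-- Diagonalise against the n-porous sets A₀, A₁, … with a single x built from
-- finite strings S₀ ⊑ S₁ ⊑ ⋯: S_{k+1} is S_k followed by the porosity hole of
-- A_k above S_k and then by zeros that more than double the length.  Then x
-- avoids every A_k, and its ones lie in blocks [p_k, p_k + n), p_k = |S_k|,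
-- with p_{k+1} > 2 (p_k + n).  Hence two ones y < y + d with d ≥ n satisfy
-- y < d, which the terms a + n r and a + 2 n r of an arithmetic progression of
-- length 2n + 1 violate; so x ∈ E_{2n+1} ⊆ 𝒲.
module Submission where

open import Defs
open import Data.Nat using (ℕ; zero; suc; _+_; _*_; _≤_; _<_; z≤n; s≤s; z<s; _≤′_; ≤′-refl; ≤′-step; _≤?_)
open import Data.Nat.Properties
open import Data.Bool using (Bool; true; false)
open import Data.List using (List; []; _∷_; _++_; length; replicate)
open import Data.List.Properties using (length-++; length-replicate)
open import Data.List.Relation.Binary.Prefix.Heterogeneous using (Prefix; []; _∷_; _++ᵖ_)
open import Data.List.Relation.Binary.Prefix.Heterogeneous.Properties as Prefix using (fromPointwise; length-mono)
import Data.List.Relation.Binary.Pointwise as Pointwise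
open import Data.Product using (Σ; _×_; _,_; proj₁; proj₂; uncurry)
import Data.Product as Product
open import Data.Sum using (_⊎_; inj₁; inj₂)
import Data.Sum as Sum
open import Data.Unit using (tt)
open import Data.Empty using (⊥-elim)
open import Function using (_∘′_)
open import Relation.Nullary using (¬_; yes; no)
open import Relation.Binary.PropositionalEquality

_⊑_ : List Bool → List Bool → Set
_⊑_ = Prefix _≡_

⊑-refl : ∀ {s} → s ⊑ s
⊑-refl = fromPointwise (Pointwise.refl refl)

⊑-trans : ∀ {s t u} → s ⊑ t → t ⊑ u → s ⊑ u
⊑-trans = Prefix.trans trans

-- Reading past the end gives false: a string codes the finite set of its ones.
nth : List Bool → ℕ → Bool
nth []      _       = false
nth (b ∷ s) zero    = b
nth (b ∷ s) (suc i) = nth s i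

nth-true⇒<length : ∀ s i → nth s i ≡ true → i < length s
nth-true⇒<length []      i       ()
nth-true⇒<length (b ∷ s) zero    _ = z<s
nth-true⇒<length (b ∷ s) (suc i) h = s≤s (nth-true⇒<length s i h)

nth-⊑ : ∀ {s t} → s ⊑ t → ∀ {i} → i < length s → nth t i ≡ nth s i
nth-⊑ (refl ∷ _)   {zero}  _         = refl
nth-⊑ (refl ∷ s⊑t) {suc i} (s≤s i<s) = nth-⊑ s⊑t i<s

nth-++-replicate-false : ∀ s m i → nth (s ++ replicate m false) i ≡ nth s i
nth-++-replicate-false []      zero    i       = refl
nth-++-replicate-false []      (suc m) zero    = refl
nth-++-replicate-false []      (suc m) (suc i) = nth-++-replicate-false [] m i
nth-++-replicate-false (b ∷ s) m       zero    = refl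
nth-++-replicate-false (b ∷ s) m       (suc i) = nth-++-replicate-false s m i

nth-++-true : ∀ s u i → nth (s ++ u) i ≡ true →
              nth s i ≡ true ⊎ (length s ≤ i × i < length s + length u)
nth-++-true []      u i       h = inj₂ (z≤n , nth-true⇒<length u i h)
nth-++-true (b ∷ s) u zero    h = inj₁ h
nth-++-true (b ∷ s) u (suc i) h = Sum.map₂ (Product.map s≤s s≤s) (nth-++-true s u i h)

Extends-nth : ∀ s {x : Cantor} → (∀ i → i < length s → x i ≡ nth s i) → Extends s x
Extends-nth []      _    = tt
Extends-nth (b ∷ s) x≈s = x≈s 0 z<s , Extends-nth s (λ i i<s → x≈s (suc i) (s≤s i<s))

Extends-⊑ : ∀ {s t} {x : Cantor} → s ⊑ t → Extends t x → Extends s x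
Extends-⊑ []           _         = tt
Extends-⊑ (refl ∷ s⊑t) (x₀ , xt) = x₀ , Extends-⊑ s⊑t xt

module Limit (S : ℕ → List Bool) (S-step : ∀ k → S k ⊑ S (suc k))
             (S-grows : ∀ k → length (S k) < length (S (suc k))) where

  S-mono′ : ∀ {a b} → a ≤′ b → S a ⊑ S b
  S-mono′ ≤′-refl         = ⊑-refl
  S-mono′ (≤′-step a≤′b) = ⊑-trans (S-mono′ a≤′b) (S-step _)

  S-mono : ∀ {a b} → a ≤ b → S a ⊑ S b
  S-mono = S-mono′ ∘′ ≤⇒≤′

  ≤-length-S : ∀ k → k ≤ length (S k)
  ≤-length-S zero    = z≤n
  ≤-length-S (suc k) = ≤-trans (s≤s (≤-length-S k)) (S-grows k)

  limit : Cantor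
  limit i = nth (S (suc i)) i

  limit-nth : ∀ k i → i < length (S k) → limit i ≡ nth (S k) i
  limit-nth k i i<Sk with ≤-total (suc i) k
  ... | inj₁ 1+i≤k = sym (nth-⊑ (S-mono 1+i≤k) (≤-length-S (suc i)))
  ... | inj₂ k≤1+i = nth-⊑ (S-mono k≤1+i) i<Sk

  limit-extends : ∀ k → Extends (S k) limit
  limit-extends k = Extends-nth (S k) (limit-nth k)

Lacunary : ℕ → Cantor → Set
Lacunary n x = ∀ y d → n ≤ d → x y ≡ true → x (y + d) ≡ true → y < d

lacunary⇒E : ∀ {n x} → Lacunary n x → E (suc (n + n)) x
lacunary⇒E {n} {x} lacunary (a , suc r , _ , ap) =
  <⇒≱ (lacunary (a + d) d (m≤m*n n (suc r)) (ap n n<2n+1) x[a+2d]) (m≤n+m d a)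
  where
  d = n * suc r
  n<2n+1 : n < suc (n + n)
  n<2n+1 = s≤s (m≤m+n n n)
  x[a+2d] : x (a + d + d) ≡ true
  x[a+2d] = subst (λ i → x i ≡ true)
                  (trans (cong (a +_) (*-distribʳ-+ (suc r) n n)) (sym (+-assoc a d d)))
                  (ap (n + n) ≤-refl)

pad : List Bool → List Bool
pad s = s ++ replicate (suc (length s)) false

length-pad : ∀ s → length (pad s) ≡ length s + suc (length s)
length-pad s = trans (length-++ s) (cong (length s +_) (length-replicate (suc (length s))))

nth-pad : ∀ s i → nth (pad s) i ≡ nth s i
nth-pad s = nth-++-replicate-false s (suc (length s))

module Construction (n : ℕ) (A : ℕ → SubsetOfCantor) (porous : ∀ k → NPorous n (A k)) where

  hole : ℕ → List Bool → List Bool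
  hole k s = proj₁ (porous k s)

  S : ℕ → List Bool
  S zero    = []
  S (suc k) = pad (S k ++ hole k (S k))

  length-hole : ∀ k s → length (hole k s) ≡ n
  length-hole k s = proj₁ (proj₂ (porous k s))

  length-S-suc : ∀ k → length (S (suc k)) ≡ (length (S k) + n) + suc (length (S k) + n)
  length-S-suc k = begin
    length (pad (S k ++ hole k (S k)))           ≡⟨ length-pad (S k ++ hole k (S k)) ⟩
    m + suc m                                    ≡⟨ cong (λ l → l + suc l) m≡ ⟩
    (length (S k) + n) + suc (length (S k) + n)  ∎
    where
    open ≡-Reasoning
    m = length (S k ++ hole k (S k))
    m≡ : m ≡ length (S k) + n
    m≡ = trans (length-++ (S k)) (cong (length (S k) +_) (length-hole k (S k)))

  S-step : ∀ k → S k ⊑ S (suc k)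
  S-step k = (⊑-refl ++ᵖ hole k (S k)) ++ᵖ _

  S-grows : ∀ k → length (S k) < length (S (suc k))
  S-grows k = subst (length (S k) <_) (sym (length-S-suc k))
                    (≤-<-trans (m≤m+n _ n) (m<m+n _ z<s))

  open Limit S S-step S-grows public

  limit-avoids : ∀ k → ¬ A k limit
  limit-avoids k = proj₂ (proj₂ (porous k (S k))) limit
                          (Extends-⊑ (⊑-refl ++ᵖ _) (limit-extends (suc k)))

  InBlock : ℕ → ℕ → Set
  InBlock j y = length (S j) ≤ y × y < length (S j) + n

  S-ones-in-blocks : ∀ k y → nth (S k) y ≡ true → Σ ℕ λ j → InBlock j y
  S-ones-in-blocks zero    y ()
  S-ones-in-blocks (suc k) y Sy
    with nth-++-true (S k) (hole k (S k)) y (trans (sym (nth-pad (S k ++ hole k (S k)) y)) Sy)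
  ... | inj₁ Sky            = S-ones-in-blocks k y Sky
  ... | inj₂ (Sk≤y , y<Skh) = k , Sk≤y , subst (λ m → y < length (S k) + m) (length-hole k (S k)) y<Skh

  blocks-lacunary : ∀ j k {y d} → InBlock j y → InBlock k (y + d) → n ≤ d → y < d
  blocks-lacunary j k {y} {d} (Sj≤y , y<Sj+n) (Sk≤y+d , y+d<Sk+n) n≤d with k ≤? j
  ... | yes k≤j = ⊥-elim (<⇒≱ (+-cancelˡ-< y d n (begin-strict
          y + d             <⟨ y+d<Sk+n ⟩
          length (S k) + n  ≤⟨ +-monoˡ-≤ n (length-mono (S-mono k≤j)) ⟩
          length (S j) + n  ≤⟨ +-monoˡ-≤ n Sj≤y ⟩
          y + n             ∎)) n≤d)
    where open ≤-Reasoning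
  ... | no k≰j = +-cancelˡ-≤ y (suc y) d (begin
          y + suc y                                    ≤⟨ +-mono-≤ (<⇒≤ y<Sj+n) (m≤n⇒m≤1+n y<Sj+n) ⟩
          (length (S j) + n) + suc (length (S j) + n)  ≡⟨ length-S-suc j ⟨
          length (S (suc j))                           ≤⟨ length-mono (S-mono (≰⇒> k≰j)) ⟩
          length (S k)                                 ≤⟨ Sk≤y+d ⟩
          y + d                                        ∎)
    where open ≤-Reasoning

  limit-lacunary : Lacunary n limit
  limit-lacunary y d n≤d xy xy+d
    with S-ones-in-blocks (suc y) y xy | S-ones-in-blocks (suc (y + d)) (y + d) xy+d
  ... | j , y∈j | k , y+d∈k = blocks-lacunary j k y∈j y+d∈k n≤d

  limit∈W : W limit
  limit∈W = suc (n + n) , s≤s z≤n , lacunary⇒E limit-lacunary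

mainTheorem3 : ∀ (n : ℕ) → ¬ InSP n W
mainTheorem3 n (A , porous , cover) = uncurry limit-avoids (cover limit limit∈W)
  where open Construction n A porous
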